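{- Let $\alpha\ge1$ and $\Delta\ge 5\alpha$, and consider the anti-reset algorithm (described in the context) run on an arboricity-$\alpha$ preserving sequence of $t$ edge updates starting from the empty graph. Then the total running time of the algorithm is $O(t+F)$, where $F$ is the total number of edge flips it performs.
   Context: Arboricity of $G=(V,E)$: $\max_{U\subseteq V,|U|\ge2}\lceil |E(U)|/(|U|-1)\rceil$; an arboricity-$\alpha$ preserving sequence keeps the arboricity at most $\alpha$ at all times. The anti-reset algorithm with threshold $\Delta$ maintains an orientation of the edges. A deletion simply removes the edge; an inserted edge is oriented arbitrarily. If after an insertion some vertex $u$ has outdegree greater than $\Delta$, set $\Delta'=\Delta-2\alpha$ and explore from $u$ along outgoing edges: every reached vertex of outdegree greater than $\Delta'$ is internal and all its out-neighbors are explored; every reached vertex of outdegree at most $\Delta'$ is a boundary vertex and is not explored further. Let $\overrightarrow{G_u}$ be the digraph on the reached vertices whose edges are all outgoing edges of internal vertices. Color all edges of $\overrightarrow{G_u}$. Repeatedly pick a vertex of $\overrightarrow{G_u}$ incident to at most $2\alpha$ colored edges, perform an anti-reset on it (flip all its colored incoming edges so they become outgoing of it) and uncolor all its incident colored edges, until no colored edge remains. This yields an orientation of $\overrightarrow{G_u}$ with outdegree at most $2\alpha$ within $\overrightarrow{G_u}$, and keeps all outdegrees at most $\Delta+1$ at all times. -}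

module Defs where

open import Data.Nat using (ℕ; zero; suc; _+_; _*_; _∸_; _≤_; _<_; _/_)
open import Data.Nat.Properties using (_<?_)
open import Data.Bool using (Bool; true; false; _∧_; _∨_; if_then_else_)
open import Data.Fin using (Fin; _≟_)
import Data.Fin as F
open import Data.Fin.Subset using (Subset; ∣_∣; _∈_)
open import Data.Vec using (tabulate; lookup)
open import Data.List using (List; []; _∷_; map; allFin)
open import Data.Nat.ListAction using (sum)
open import Data.Product using (_×_; _,_)
open import Data.Sum using (_⊎_)
open import Relation.Nullary using (¬_)
open import Relation.Nullary.Decidable using (⌊_⌋)
open import Relation.Binary.PropositionalEquality using (_≡_; _≢_)

count : ∀ {n} → (Fin n → Bool) → ℕ
count p = ∣ tabulate p ∣

sumFin : ∀ {n} → (Fin n → ℕ) → ℕ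
sumFin {n} f = sum (map f (allFin n))

-- ⌈ a / b ⌉  (b = 0 gives 0; only used with b ≥ 1)
ceilDiv : ℕ → ℕ → ℕ
ceilDiv a zero    = 0
ceilDiv a (suc b) = (a + b) / suc b

eqB : ∀ {n} → Fin n → Fin n → Bool
eqB a b = ⌊ a ≟ b ⌋

-- Undirected simple graphs on the vertex set Fin n (adjacency, symmetric)

Graph : ℕ → Set
Graph n = Fin n → Fin n → Bool

emptyG : ∀ {n} → Graph n
emptyG _ _ = false

addE : ∀ {n} → Graph n → Fin n → Fin n → Graph n
addE G x y a b =
  if (eqB a x ∧ eqB b y) ∨ (eqB a y ∧ eqB b x) then true else G a b

delE : ∀ {n} → Graph n → Fin n → Fin n → Graph n
delE G x y a b =
  if (eqB a x ∧ eqB b y) ∨ (eqB a y ∧ eqB b x) then false else G a b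

edgesIn : ∀ {n} → Graph n → Subset n → ℕ
edgesIn G U = sumFin λ i →
  count λ j → ⌊ F._<?_ i j ⌋ ∧ lookup U i ∧ lookup U j ∧ G i j

-- arboricity(G) ≤ α, i.e. max_{U, |U| ≥ 2} ⌈ |E(U)| / (|U|-1) ⌉ ≤ α
ArbAtMost : ∀ {n} → ℕ → Graph n → Set
ArbAtMost α G = ∀ U → 2 ≤ ∣ U ∣ → ceilDiv (edgesIn G U) (∣ U ∣ ∸ 1) ≤ α

data Update (n : ℕ) : Set where
  ins : Fin n → Fin n → Update n
  del : Fin n → Fin n → Update n

data Preserving {n} (α : ℕ) : Graph n → List (Update n) → Set where
  []  : ∀ {G} → Preserving α G []
  ins : ∀ {G x y us} → x ≢ y → G x y ≡ false →
        ArbAtMost α (addE G x y) → Preserving α (addE G x y) us →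
        Preserving α G (ins x y ∷ us)
  del : ∀ {G x y us} → G x y ≡ true →
        ArbAtMost α (delE G x y) → Preserving α (delE G x y) us →
        Preserving α G (del x y ∷ us)

ArbPreservingSeq : ∀ {n} → ℕ → List (Update n) → Set
ArbPreservingSeq α us = Preserving α emptyG us

-- Orientations: o a b ≡ true iff the edge {a,b} is present, oriented a → b

Ori : ℕ → Set
Ori n = Fin n → Fin n → Bool

emptyO : ∀ {n} → Ori n
emptyO _ _ = false

outdeg : ∀ {n} → Ori n → Fin n → ℕ
outdeg o v = count (o v)

orientIns : ∀ {n} → Ori n → Fin n → Fin n → Ori n
orientIns o x y a b =
  if eqB a x ∧ eqB b y then true
  else if eqB a y ∧ eqB b x then false
  else o a b

orientDel : ∀ {n} → Ori n → Fin n → Fin n → Ori n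
orientDel o x y a b =
  if (eqB a x ∧ eqB b y) ∨ (eqB a y ∧ eqB b x) then false else o a b

-- Exploration from u with threshold Δ' : vertices reached along outgoing
-- edges, where only vertices of outdegree > Δ' (internal) are expanded.

isInternalB : ∀ {n} → Ori n → ℕ → Fin n → Bool
isInternalB o Δ' v = ⌊ Δ' <? outdeg o v ⌋

data Reach {n} (o : Ori n) (Δ' : ℕ) (u : Fin n) : Fin n → Set where
  start : Reach o Δ' u u
  step  : ∀ {v w} → Reach o Δ' u v → Δ' < outdeg o v → o v w ≡ true →
          Reach o Δ' u w

internal : ∀ {n} → Ori n → ℕ → Subset n → Fin n → Bool
internal o Δ' R v = lookup R v ∧ isInternalB o Δ' v

edgesGu : ∀ {n} → Ori n → ℕ → Subset n → ℕ
edgesGu o Δ' R = sumFin λ v → if internal o Δ' R v then outdeg o v else 0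

-- Coloring (symmetric: col a b ≡ col b a ≡ true iff edge {a,b} colored)

Col : ℕ → Set
Col n = Fin n → Fin n → Bool

colGu : ∀ {n} → Ori n → ℕ → Subset n → Col n
colGu o Δ' R a b = (internal o Δ' R a ∧ o a b) ∨ (internal o Δ' R b ∧ o b a)

colDeg : ∀ {n} → Col n → Fin n → ℕ
colDeg c v = count (c v)

arOri : ∀ {n} → Ori n → Col n → Fin n → Ori n
arOri o c v a b =
  if eqB a v ∧ c v b then true
  else if eqB b v ∧ c v a then false
  else o a b

arCol : ∀ {n} → Col n → Fin n → Col n
arCol c v a b = if eqB a v ∨ eqB b v then false else c a b

arFlips : ∀ {n} → Ori n → Col n → Fin n → ℕ
arFlips o c v = count λ w → c v w ∧ o w v

data ARPhase {n} (α : ℕ) (R : Subset n) : Ori n → Col n → Ori n → ℕ → Set where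
  done : ∀ {o c} → (∀ a b → c a b ≡ false) → ARPhase α R o c o 0
  step : ∀ {o c o' f} (v : Fin n) → v ∈ R → colDeg c v ≤ 2 * α →
         ARPhase α R (arOri o c v) (arCol c v) o' f →
         ARPhase α R o c o' (arFlips o c v + f)

-- One insertion: InsStep α Δ o x y o' cost flips
-- Cost model: O(1) for the insertion itself, plus
-- |V(G_u)| + |E(G_u)| for exploring G_u and running the anti-reset phase.

data InsStep {n} (α Δ : ℕ) (o : Ori n) (x y : Fin n) : Ori n → ℕ → ℕ → Set where
  quiet : ∀ a b → (a ≡ x × b ≡ y) ⊎ (a ≡ y × b ≡ x) →
          (∀ v → outdeg (orientIns o a b) v ≤ Δ) →
          InsStep α Δ o x y (orientIns o a b) 1 0
  fix   : ∀ a b → (a ≡ x × b ≡ y) ⊎ (a ≡ y × b ≡ x) →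
          (u : Fin n) → Δ < outdeg (orientIns o a b) u →
          (R : Subset n) →
          (∀ v → (v ∈ R → Reach (orientIns o a b) (Δ ∸ 2 * α) u v)
               × (Reach (orientIns o a b) (Δ ∸ 2 * α) u v → v ∈ R)) →
          ∀ {o' f} →
          ARPhase α R (orientIns o a b)
                      (colGu (orientIns o a b) (Δ ∸ 2 * α) R) o' f →
          InsStep α Δ o x y o'
                  (1 + ∣ R ∣ + edgesGu (orientIns o a b) (Δ ∸ 2 * α) R) f

data Run {n} (α Δ : ℕ) : Ori n → List (Update n) → Ori n → ℕ → ℕ → Set where
  []  : ∀ {o} → Run α Δ o [] o 0 0
  ins : ∀ {o x y us o₁ o₂ c₁ f₁ c₂ f₂} →
        InsStep α Δ o x y o₁ c₁ f₁ → Run α Δ o₁ us o₂ c₂ f₂ →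
        Run α Δ o (ins x y ∷ us) o₂ (c₁ + c₂) (f₁ + f₂)
  del : ∀ {o x y us o₂ c₂ f₂} →
        Run α Δ (orientDel o x y) us o₂ c₂ f₂ →
        Run α Δ o (del x y ∷ us) o₂ (1 + c₂) f₂

module Submission where

-- Updates cost O(1) each, except an insertion that triggers an exploration
-- of G_u, which costs 1 + |V(G_u)| + |E(G_u)|.  We charge this to the flips
-- of the ensuing anti-reset phase by a potential argument.  The potential of
-- a colouring is the excess  Φ = Σ_w max(0, colOut(w) - 2α), where colOut(w)
-- counts the coloured edges leaving w.
--   * An anti-reset on v (incident to ≤ 2α coloured edges) lowers Φ by at
--     most the number of edges it flips; when no edge is coloured Φ = 0.
--     Hence Φ(initial colouring) ≤ total flips of the phase.
--   * Initially every edge of G_u is coloured and leaves an internal vertex,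
--     whose outdegree exceeds Δ - 2α ≥ 3α; so |E(G_u)| ≤ 3Φ.
--   * Every reached vertex except u has an in-edge from an internal vertex,
--     so |V(G_u)| ≤ 1 + |E(G_u)|.
-- Thus an insertion with f flips costs at most 6(1 + f), and summing over
-- the run gives cost ≤ 6(t + F).  The amortisation needs only Δ ≥ 5α; the
-- arboricity assumptions matter for bounding F itself, not for this lemma.

open import Defs
open import Data.Nat using (ℕ; zero; suc; _+_; _*_; _∸_; _≤_; _<_; z≤n; s≤s)
open import Data.Nat.Properties
  using ( +-*-semiring; _<?_; ≤-refl; ≤-trans; ≤-reflexive; <⇒≤; ≤-<-trans
        ; +-mono-≤; +-monoˡ-≤; +-monoʳ-≤; *-monoʳ-≤; *-monoˡ-≤; m≤m+n; m≤n+m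
        ; +-identityʳ; +-comm; +-suc; m∸n≤m; n≤1+n; ≤-pred; m≤n⇒m∸n≡0
        ; m+[n∸m]≡n; +-cancelˡ-<; m+n≤o⇒m≤o∸n; *-distribʳ-+; *-distribˡ-+
        ; module ≤-Reasoning )
open import Data.Nat.Tactic.RingSolver using (solve-∀)
open import Data.Bool using (Bool; true; false; _∧_; _∨_; if_then_else_)
open import Data.Bool.Properties using (∧-zeroʳ; ∨-comm)
open import Data.Fin using (Fin; zero; suc; _≟_)
open import Data.Fin.Subset using (Subset; ∣_∣; _∈_)
open import Data.Vec using (Vec; []; _∷_; lookup; tabulate)
open import Data.Vec.Properties using (lookup∘tabulate; []=⇒lookup; lookup⇒[]=)
open import Data.List using (List; length)
import Data.List as List
open import Data.List.Properties using (map-tabulate)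
open import Data.Nat.ListAction using () renaming (sum to listSum)
open import Data.Product using (∃-syntax; _,_; proj₁; proj₂; _×_)
open import Relation.Nullary using (Dec; yes; no; ¬_)
open import Relation.Nullary.Decidable using (⌊_⌋; isYes≗does; dec-true; dec-false)
open import Relation.Nullary.Negation using (contradiction)
open import Relation.Binary.PropositionalEquality
  using (_≡_; _≢_; refl; sym; trans; cong; cong₂; module ≡-Reasoning)
open import Algebra.Properties.Semiring.Sum +-*-semiring
  using (sum; sum-cong-≗; sum-replicate-zero; ∑-distrib-+; ∑-comm; *-distribˡ-sum)

𝟙 : Bool → ℕ
𝟙 true  = 1
𝟙 false = 0

𝟙-∧ : ∀ a b → 𝟙 (a ∧ b) ≤ 𝟙 a
𝟙-∧ true  true  = ≤-refl
𝟙-∧ true  false = z≤n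
𝟙-∧ false b     = z≤n

sum-mono : ∀ {n} {f g : Fin n → ℕ} → (∀ i → f i ≤ g i) → sum f ≤ sum g
sum-mono {zero}  f≤g = z≤n
sum-mono {suc n} f≤g = +-mono-≤ (f≤g zero) (sum-mono (λ i → f≤g (suc i)))

term≤sum : ∀ {n} (f : Fin n → ℕ) (i : Fin n) → f i ≤ sum f
term≤sum f zero    = m≤m+n _ _
term≤sum f (suc i) = ≤-trans (term≤sum (λ j → f (suc j)) i) (m≤n+m _ _)

sum-zero : ∀ {n} {f : Fin n → ℕ} → (∀ i → f i ≡ 0) → sum f ≡ 0
sum-zero {n} f≡0 = trans (sum-cong-≗ f≡0) (sum-replicate-zero n)

⌊⌋-true : ∀ {P : Set} (d : Dec P) → P → ⌊ d ⌋ ≡ true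
⌊⌋-true d p = trans (isYes≗does d) (dec-true d p)

⌊⌋-false : ∀ {P : Set} (d : Dec P) → ¬ P → ⌊ d ⌋ ≡ false
⌊⌋-false d ¬p = trans (isYes≗does d) (dec-false d ¬p)

pointAt : ∀ {n} → Fin n → ℕ → Fin n → ℕ
pointAt v x z = if eqB z v then x else 0

pointAt-here : ∀ {n} (v : Fin n) x → pointAt v x v ≡ x
pointAt-here v x = cong (if_then x else 0) (⌊⌋-true (v ≟ v) refl)

sum-pointAt : ∀ {n} (v : Fin n) x → sum (pointAt v x) ≡ x
sum-pointAt {suc n} zero    x = trans (cong (x +_) (sum-replicate-zero n)) (+-identityʳ x)
sum-pointAt {suc n} (suc v) x =
  trans (sum-cong-≗ shift) (sum-pointAt v x)
  where
  shift : ∀ z → pointAt (suc v) x (suc z) ≡ pointAt v x z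
  shift z = cong (if_then x else 0)
                 (trans (isYes≗does (suc z ≟ suc v)) (sym (isYes≗does (z ≟ v))))

sum-≤-except : ∀ {n} {f g : Fin n → ℕ} (v : Fin n) →
  (∀ z → z ≢ v → f z ≤ g z) → sum f ≤ f v + sum g
sum-≤-except {f = f} {g} v f≤g = begin
  sum f                               ≤⟨ sum-mono bound ⟩
  sum (λ z → pointAt v (f v) z + g z) ≡⟨ ∑-distrib-+ (pointAt v (f v)) g ⟩
  sum (pointAt v (f v)) + sum g       ≡⟨ cong (_+ sum g) (sum-pointAt v (f v)) ⟩
  f v + sum g                         ∎
  where
  open ≤-Reasoning
  bound : ∀ z → f z ≤ pointAt v (f v) z + g z
  bound z with z ≟ v
  ... | yes refl = m≤m+n (f z) (g z)
  ... | no z≢v   = ≤-trans (f≤g z z≢v) (m≤n+m _ _)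

card-as-sum : ∀ {n} (V : Vec Bool n) → ∣ V ∣ ≡ sum (λ i → 𝟙 (lookup V i))
card-as-sum []          = refl
card-as-sum (true ∷ V)  = cong suc (card-as-sum V)
card-as-sum (false ∷ V) = card-as-sum V

count-as-sum : ∀ {n} (p : Fin n → Bool) → count p ≡ sum (λ i → 𝟙 (p i))
count-as-sum p =
  trans (card-as-sum (tabulate p)) (sum-cong-≗ (λ i → cong 𝟙 (lookup∘tabulate p i)))

sumFin-as-sum : ∀ {n} (f : Fin n → ℕ) → sumFin f ≡ sum f
sumFin-as-sum {n} f = trans (cong listSum (map-tabulate {n = n} (λ i → i) f)) (tabulated f)
  where
  tabulated : ∀ {m} (h : Fin m → ℕ) → listSum (List.tabulate h) ≡ sum h
  tabulated {zero}  h = refl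
  tabulated {suc m} h = cong (h zero +_) (tabulated (λ i → h (suc i)))

m≤n+o⇒m∸k≤n+[o∸k] : ∀ m n o k → m ≤ n + o → m ∸ k ≤ n + (o ∸ k)
m≤n+o⇒m∸k≤n+[o∸k] m       n o       zero    m≤n+o = m≤n+o
m≤n+o⇒m∸k≤n+[o∸k] zero    n o       (suc k) _     = z≤n
m≤n+o⇒m∸k≤n+[o∸k] (suc m) n zero    (suc k) m≤n+o =
  ≤-trans (m∸n≤m m k) (≤-trans (n≤1+n m) m≤n+o)
m≤n+o⇒m∸k≤n+[o∸k] (suc m) n (suc o) (suc k) m≤n+o =
  m≤n+o⇒m∸k≤n+[o∸k] m n o k (≤-pred (≤-trans m≤n+o (≤-reflexive (+-suc n o))))

heavy⇒≤3·excess : ∀ a d → 3 * a < d → d ≤ 3 * (d ∸ 2 * a)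
heavy⇒≤3·excess a d 3a<d = begin
  d               ≡⟨ sym d≡2a+m ⟩
  2 * a + m       ≤⟨ +-monoˡ-≤ m (*-monoʳ-≤ 2 (<⇒≤ a<m)) ⟩
  2 * m + m       ≡⟨ +-comm (2 * m) m ⟩
  3 * m           ∎
  where
  open ≤-Reasoning
  m = d ∸ 2 * a
  d≡2a+m : 2 * a + m ≡ d
  d≡2a+m = m+[n∸m]≡n (≤-trans (*-monoˡ-≤ a {2} {3} (s≤s (s≤s z≤n))) (<⇒≤ 3a<d))
  a<m : a < m
  a<m = +-cancelˡ-< (2 * a) a m
          (≤-trans (≤-reflexive (cong suc (+-comm (2 * a) a)))
                   (≤-trans 3a<d (≤-reflexive (sym d≡2a+m))))

colOut : ∀ {n} → Ori n → Col n → Fin n → ℕ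
colOut o c w = sum (λ z → 𝟙 (c w z ∧ o w z))

excess : ∀ {n} → ℕ → Ori n → Col n → ℕ
excess α o c = sum (λ w → colOut o c w ∸ 2 * α)

SymCol : ∀ {n} → Col n → Set
SymCol c = ∀ a b → c a b ≡ c b a

arCol-sym : ∀ {n} {c : Col n} v → SymCol c → SymCol (arCol c v)
arCol-sym {c = c} v sym-c a b =
  cong₂ (λ p q → if p then false else q) (∨-comm (eqB a v) (eqB b v)) (sym-c a b)

arCol-away : ∀ {n} (c : Col n) {v w z : Fin n} → w ≢ v → z ≢ v →
  arCol c v w z ≡ c w z
arCol-away c {v} {w} {z} w≢v z≢v =
  cong₂ (λ p q → if p ∨ q then false else c w z)
        (⌊⌋-false (w ≟ v) w≢v) (⌊⌋-false (z ≟ v) z≢v)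

arOri-away : ∀ {n} (o : Ori n) (c : Col n) {v w z : Fin n} → w ≢ v → z ≢ v →
  arOri o c v w z ≡ o w z
arOri-away o c {v} {w} {z} w≢v z≢v =
  cong₂ (λ p q → if p ∧ c v z then true else if q ∧ c v w then false else o w z)
        (⌊⌋-false (w ≟ v) w≢v) (⌊⌋-false (z ≟ v) z≢v)

-- A vertex w ≠ v loses at most its coloured edge w → v, which the
-- anti-reset on v flips.
antiReset-colOut : ∀ {n} (o : Ori n) (c : Col n) {v w : Fin n} → SymCol c → w ≢ v →
  colOut o c w ≤ 𝟙 (c v w ∧ o w v) + colOut (arOri o c v) (arCol c v) w
antiReset-colOut o c {v} {w} sym-c w≢v =
  ≤-trans (sum-≤-except v unchanged)
          (≤-reflexive (cong (λ b → 𝟙 (b ∧ o w v) + colOut o' c' w) (sym-c w v)))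
  where
  o' = arOri o c v
  c' = arCol c v
  unchanged : ∀ z → z ≢ v → 𝟙 (c w z ∧ o w z) ≤ 𝟙 (c' w z ∧ o' w z)
  unchanged z z≢v = ≤-reflexive (sym (cong₂ (λ p q → 𝟙 (p ∧ q))
                      (arCol-away c w≢v z≢v) (arOri-away o c w≢v z≢v)))

antiReset-excess : ∀ {n} α (o : Ori n) (c : Col n) (v : Fin n) → SymCol c →
  colDeg c v ≤ 2 * α →
  excess α o c ≤ arFlips o c v + excess α (arOri o c v) (arCol c v)
antiReset-excess α o c v sym-c light = begin
  excess α o c
    ≤⟨ sum-mono perVertex ⟩
  sum (λ w → 𝟙 (c v w ∧ o w v) + (colOut (arOri o c v) (arCol c v) w ∸ 2 * α))
    ≡⟨ ∑-distrib-+ (λ w → 𝟙 (c v w ∧ o w v)) _ ⟩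
  sum (λ w → 𝟙 (c v w ∧ o w v)) + excess α (arOri o c v) (arCol c v)
    ≡⟨ cong (_+ excess α (arOri o c v) (arCol c v))
            (sym (count-as-sum (λ w → c v w ∧ o w v))) ⟩
  arFlips o c v + excess α (arOri o c v) (arCol c v)
    ∎
  where
  open ≤-Reasoning
  -- v itself has no excess: it is incident to at most 2α coloured edges.
  vLight : colOut o c v ≤ 2 * α
  vLight = ≤-trans (sum-mono (λ z → 𝟙-∧ (c v z) (o v z)))
                   (≤-trans (≤-reflexive (sym (count-as-sum (c v)))) light)

  perVertexDec : ∀ w → Dec (w ≡ v) → colOut o c w ∸ 2 * α ≤
                 𝟙 (c v w ∧ o w v) + (colOut (arOri o c v) (arCol c v) w ∸ 2 * α)
  perVertexDec w (yes refl) = ≤-trans (≤-reflexive (m≤n⇒m∸n≡0 vLight)) z≤n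
  perVertexDec w (no w≢v)   =
    m≤n+o⇒m∸k≤n+[o∸k] _ _ _ (2 * α) (antiReset-colOut o c sym-c w≢v)

  perVertex : ∀ w → colOut o c w ∸ 2 * α ≤
                    𝟙 (c v w ∧ o w v) + (colOut (arOri o c v) (arCol c v) w ∸ 2 * α)
  perVertex w = perVertexDec w (w ≟ v)

excess≤flips : ∀ {n α} {R : Subset n} {o c o' f} → SymCol c →
  ARPhase α R o c o' f → excess α o c ≤ f
excess≤flips {α = α} {o = o} {c} sym-c (done uncoloured) =
  ≤-reflexive (sum-zero {f = λ w → colOut o c w ∸ 2 * α} noExcess)
  where
  noColOut : ∀ w → colOut o c w ≡ 0
  noColOut w = sum-zero {f = λ z → 𝟙 (c w z ∧ o w z)}
                        (λ z → cong (λ b → 𝟙 (b ∧ o w z)) (uncoloured w z))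
  noExcess : ∀ w → colOut o c w ∸ 2 * α ≡ 0
  noExcess w = m≤n⇒m∸n≡0 (≤-trans (≤-reflexive (noColOut w)) (z≤n {2 * α}))
excess≤flips {α = α} {o = o} {c} sym-c (step v _ light rest) =
  ≤-trans (antiReset-excess α o c v sym-c light)
          (+-monoʳ-≤ (arFlips o c v) (excess≤flips (arCol-sym v sym-c) rest))

colGu-sym : ∀ {n} (o : Ori n) Δ' (R : Subset n) → SymCol (colGu o Δ' R)
colGu-sym o Δ' R a b = ∨-comm (internal o Δ' R a ∧ o a b) (internal o Δ' R b ∧ o b a)

internal⇒heavy : ∀ {n} (o : Ori n) Δ' (R : Subset n) v →
  internal o Δ' R v ≡ true → Δ' < outdeg o v
internal⇒heavy o Δ' R v isInt with Δ' <? outdeg o v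
... | yes heavy = heavy
... | no _      = contradiction (trans (sym isInt) (∧-zeroʳ (lookup R v))) (λ ())

colOut-internal : ∀ {n} (o : Ori n) Δ' (R : Subset n) v → internal o Δ' R v ≡ true →
  colOut o (colGu o Δ' R) v ≡ outdeg o v
colOut-internal o Δ' R v isInt =
  trans (sum-cong-≗ (λ z → cong 𝟙 (keepsOut (o v z) _)))
        (sym (count-as-sum (o v)))
  where
  keepsOut : ∀ b x → ((internal o Δ' R v ∧ b) ∨ x) ∧ b ≡ b
  keepsOut b x rewrite isInt with b
  ... | true  = refl
  ... | false = ∧-zeroʳ x

-- |E(G_u)| ≤ 3Φ, because every internal vertex is heavy (Δ' ≥ 3α).
edgesGu≤3·excess : ∀ {n} α (o : Ori n) Δ' (R : Subset n) → 3 * α ≤ Δ' →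
  edgesGu o Δ' R ≤ 3 * excess α o (colGu o Δ' R)
edgesGu≤3·excess α o Δ' R 3α≤Δ' =
  ≤-trans (≤-reflexive (sumFin-as-sum (λ v → if internal o Δ' R v then outdeg o v else 0)))
    (≤-trans (sum-mono perVertex)
      (≤-reflexive (sym (*-distribˡ-sum 3 (λ w → colOut o (colGu o Δ' R) w ∸ 2 * α)))))
  where
  perVertex : ∀ v → (if internal o Δ' R v then outdeg o v else 0) ≤
                    3 * (colOut o (colGu o Δ' R) v ∸ 2 * α)
  perVertex v = byStatus (internal o Δ' R v) refl
    where
    byStatus : ∀ b → internal o Δ' R v ≡ b → (if b then outdeg o v else 0) ≤
                     3 * (colOut o (colGu o Δ' R) v ∸ 2 * α)
    byStatus false _     = z≤n
    byStatus true  isInt =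
      ≤-trans (heavy⇒≤3·excess α (outdeg o v)
                 (≤-<-trans 3α≤Δ' (internal⇒heavy o Δ' R v isInt)))
              (≤-reflexive (cong (λ d → 3 * (d ∸ 2 * α))
                                 (sym (colOut-internal o Δ' R v isInt))))

edgesGu-as-sum : ∀ {n} (o : Ori n) Δ' (R : Subset n) →
  edgesGu o Δ' R ≡ sum (λ w → sum (λ v → 𝟙 (internal o Δ' R w ∧ o w v)))
edgesGu-as-sum o Δ' R =
  trans (sumFin-as-sum (λ w → if internal o Δ' R w then outdeg o w else 0))
        (sum-cong-≗ outEdges)
  where
  outEdges : ∀ w → (if internal o Δ' R w then outdeg o w else 0) ≡
                   sum (λ v → 𝟙 (internal o Δ' R w ∧ o w v))
  outEdges w with internal o Δ' R w
  ... | true  = count-as-sum (o w)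
  ... | false = sym (sum-zero {f = λ v → 𝟙 (false ∧ o w v)} (λ _ → refl))

Explored : ∀ {n} → Ori n → ℕ → Fin n → Subset n → Set
Explored o Δ' u R = ∀ v → (v ∈ R → Reach o Δ' u v) × (Reach o Δ' u v → v ∈ R)

-- Every reached vertex is u or the head of an edge of G_u, so
-- |V(G_u)| ≤ 1 + |E(G_u)|.
reached≤1+edgesGu : ∀ {n} (o : Ori n) Δ' (R : Subset n) (u : Fin n) →
  Explored o Δ' u R → ∣ R ∣ ≤ 1 + edgesGu o Δ' R
reached≤1+edgesGu o Δ' R u explored = begin
  ∣ R ∣
    ≡⟨ card-as-sum R ⟩
  sum (λ v → 𝟙 (lookup R v))
    ≤⟨ sum-mono perVertex ⟩
  sum (λ v → pointAt u 1 v + inDeg v)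
    ≡⟨ ∑-distrib-+ (pointAt u 1) inDeg ⟩
  sum (pointAt u 1) + sum inDeg
    ≡⟨ cong₂ _+_ (sum-pointAt u 1) (∑-comm (λ v w → edge w v)) ⟩
  1 + sum (λ w → sum (λ v → edge w v))
    ≡⟨ cong suc (sym (edgesGu-as-sum o Δ' R)) ⟩
  1 + edgesGu o Δ' R
    ∎
  where
  open ≤-Reasoning
  edge : Fin _ → Fin _ → ℕ
  edge w v = 𝟙 (internal o Δ' R w ∧ o w v)

  inDeg : Fin _ → ℕ
  inDeg v = sum (λ w → edge w v)

  reachedBound : ∀ {v} → Reach o Δ' u v → 1 ≤ pointAt u 1 v + inDeg v
  reachedBound start = ≤-trans (≤-reflexive (sym (pointAt-here u 1))) (m≤m+n _ _)
  reachedBound {v} (step {w} reachW heavy w→v) =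
    ≤-trans (≤-reflexive (cong 𝟙 (sym (cong₂ _∧_ wInternal w→v))))
            (≤-trans (term≤sum (λ w' → edge w' v) w) (m≤n+m _ _))
    where
    wInternal : internal o Δ' R w ≡ true
    wInternal = cong₂ _∧_ ([]=⇒lookup (proj₂ (explored w) reachW))
                          (⌊⌋-true (Δ' <? outdeg o w) heavy)

  perVertex : ∀ v → 𝟙 (lookup R v) ≤ pointAt u 1 v + inDeg v
  perVertex v with lookup R v in inR
  ... | false = z≤n
  ... | true  = reachedBound (proj₁ (explored v) (lookup⇒[]= v R inR))

insertion-cost : ∀ {n α Δ} {o : Ori n} {x y o' c f} → 5 * α ≤ Δ →
  InsStep α Δ o x y o' c f → c ≤ 6 * (1 + f)
insertion-cost 5α≤Δ (quiet _ _ _ _) = s≤s z≤n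
insertion-cost {α = α} {Δ} {o} 5α≤Δ (fix a b _ u _ R explored {f = f} phase) = begin
  1 + ∣ R ∣ + E           ≤⟨ +-monoˡ-≤ E (s≤s |R|≤1+E) ⟩
  2 + E + E               ≤⟨ +-mono-≤ (s≤s (s≤s E≤3f)) E≤3f ⟩
  2 + 3 * f + 3 * f       ≤⟨ m≤n+m _ 4 ⟩
  4 + (2 + 3 * f + 3 * f) ≡⟨ regroup f ⟩
  6 * (1 + f)             ∎
  where
  open ≤-Reasoning
  regroup : ∀ f → 4 + (2 + 3 * f + 3 * f) ≡ 6 * (1 + f)
  regroup = solve-∀
  o₁ = orientIns o a b
  Δ' = Δ ∸ 2 * α
  E = edgesGu o₁ Δ' R
  3α≤Δ' : 3 * α ≤ Δ'
  3α≤Δ' = m+n≤o⇒m≤o∸n (3 * α)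
            (≤-trans (≤-reflexive (sym (*-distribʳ-+ α 3 2))) 5α≤Δ)
  |R|≤1+E : ∣ R ∣ ≤ 1 + E
  |R|≤1+E = reached≤1+edgesGu o₁ Δ' R u explored
  E≤3f : E ≤ 3 * f
  E≤3f = ≤-trans (edgesGu≤3·excess α o₁ Δ' R 3α≤Δ')
                 (*-monoʳ-≤ 3 (excess≤flips (colGu-sym o₁ Δ' R) phase))

run-cost : ∀ {n α Δ} {o : Ori n} {us o' c f} → 5 * α ≤ Δ →
  Run α Δ o us o' c f → c ≤ 6 * (length us + f)
run-cost 5α≤Δ [] = z≤n
run-cost 5α≤Δ (ins {us = us} {f₁ = f₁} {f₂ = f₂} insertion rest) =
  ≤-trans (+-mono-≤ (insertion-cost 5α≤Δ insertion) (run-cost 5α≤Δ rest))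
          (≤-reflexive (regroup (length us) f₁ f₂))
  where
  regroup : ∀ t f₁ f₂ → 6 * (1 + f₁) + 6 * (t + f₂) ≡ 6 * (suc t + (f₁ + f₂))
  regroup = solve-∀
run-cost 5α≤Δ (del {us = us} {f₂ = f₂} rest) =
  ≤-trans (+-mono-≤ (s≤s (z≤n {5})) (run-cost 5α≤Δ rest))
          (≤-reflexive (sym (*-distribˡ-+ 6 1 (length us + f₂))))

lemma1 : ∃[ C ] (∀ (n α Δ : ℕ) → 1 ≤ α → 5 * α ≤ Δ →
    (us : List (Update n)) → ArbPreservingSeq α us →
    ∀ {o : Ori n} {cost flips : ℕ} → Run α Δ emptyO us o cost flips →
    cost ≤ C * (length us + flips))
lemma1 = 6 , λ n α Δ _ 5α≤Δ us _ run → run-cost 5α≤Δ run
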